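{- (1) For all $n\ge 1$, the number of permutations $\sigma\in S_n(231)$ with $\mathrm{maxdrop}(\sigma)\le 1$ equals $2^{n-1}$. (2) For all $r\ge 1$ and $n\ge 2r$, the number of permutations $\sigma\in S_n(231)$ with $\mathrm{maxdrop}(\sigma)\le 1$ and $\mathrm{des}(\sigma)=r$ equals $\binom{n}{2r}$.
   Context: For a permutation $\sigma=\sigma_1\cdots\sigma_n$ of $[n]$, $\mathrm{des}(\sigma)$ is the number of $i\in[n-1]$ with $\sigma_i>\sigma_{i+1}$, and $\mathrm{maxdrop}(\sigma)=\max\{i-\sigma_i : i\in[n]\}$. $S_n(231)$ is the set of permutations of $[n]$ with no indices $a<b<c$ such that $\sigma_c<\sigma_a<\sigma_b$. -}

module Defs where

open import Data.Nat using (ℕ; zero; suc; _+_; _∸_; _⊔_; _≤_; _<_; _≤?_; _<?_)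
open import Data.Fin using (Fin; toℕ) renaming (_<_ to _<ᶠ_; _<?_ to _<ᶠ?_)
open import Data.Fin.Properties using (all?; _≟_)
open import Data.Vec using (Vec; []; _∷_; lookup)
open import Data.List using (List; []; _∷_; [_]; map; concatMap; filter; length)
open import Data.List.Base using (allFin)
open import Data.Product using (_×_)
open import Relation.Nullary using (¬_; Dec; yes; no)
open import Relation.Nullary.Decidable using (_×-dec_; _→-dec_; ¬?)
open import Level using (0ℓ)
open import Data.Bool using (if_then_else_)
open import Relation.Nullary.Decidable using (⌊_⌋)
open import Relation.Unary using (Pred; Decidable)
open import Relation.Binary.PropositionalEquality using (_≡_)

-- A permutation of [n] in one-line notation: σ = σ₁ ⋯ σₙ is a vector of
-- length n with entries in Fin n (values shifted by one: value k+1 ↦ k),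
-- positions likewise 0-based.  It is a permutation iff the map i ↦ σᵢ is
-- injective (equivalently bijective, as it is an endomap of a finite set).
IsPerm : ∀ {n} → Vec (Fin n) n → Set
IsPerm {n} σ = ∀ (i j : Fin n) → lookup σ i ≡ lookup σ j → i ≡ j

Avoids231 : ∀ {n} → Vec (Fin n) n → Set
Avoids231 {n} σ = ∀ (a b c : Fin n) → a <ᶠ b → b <ᶠ c →
  ¬ (lookup σ c <ᶠ lookup σ a × lookup σ a <ᶠ lookup σ b)

desFrom : ∀ {n k} → Fin n → Vec (Fin n) k → ℕ
desFrom x [] = 0
desFrom x (y ∷ xs) = (if ⌊ toℕ y <? toℕ x ⌋ then 1 else 0) + desFrom y xs

desL : ∀ {n k} → Vec (Fin n) k → ℕ
desL [] = 0
desL (x ∷ xs) = desFrom x xs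

des : ∀ {n} → Vec (Fin n) n → ℕ
des = desL

-- Computed with truncated subtraction and a
-- start value 0; this agrees with the integer definition because for a
-- permutation the drops i - σᵢ sum to 0, so their maximum is ≥ 0
-- (for n ≥ 1; for n = 0 the maximum is irrelevant here).
maxdropFrom : ∀ {n k} → ℕ → Vec (Fin n) k → ℕ
maxdropFrom i [] = 0
maxdropFrom i (x ∷ xs) = (i ∸ toℕ x) ⊔ maxdropFrom (suc i) xs

-- positions and values are both shifted down by one, so i - σᵢ is unchanged
maxdrop : ∀ {n} → Vec (Fin n) n → ℕ
maxdrop σ = maxdropFrom 0 σ

isPerm? : ∀ {n} (σ : Vec (Fin n) n) → Dec (IsPerm σ)
isPerm? σ = all? λ i → all? λ j → (lookup σ i ≟ lookup σ j) →-dec (i ≟ j)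

avoids231? : ∀ {n} (σ : Vec (Fin n) n) → Dec (Avoids231 σ)
avoids231? σ = all? λ a → all? λ b → all? λ c →
  (a <ᶠ? b) →-dec ((b <ᶠ? c) →-dec
    ¬? ((lookup σ c <ᶠ? lookup σ a) ×-dec (lookup σ a <ᶠ? lookup σ b)))

allWords : ∀ n k → List (Vec (Fin n) k)
allWords n zero = [ [] ]
allWords n (suc k) = concatMap (λ x → map (x ∷_) (allWords n k)) (allFin n)

S231 : ∀ n → List (Vec (Fin n) n)
S231 n = filter (λ σ → isPerm? σ ×-dec avoids231? σ) (allWords n n)

count231 : ∀ n {P : Pred (Vec (Fin n) n) 0ℓ} → Decidable P → ℕ
count231 n P? = length (filter P? (S231 n))

module Submission where

-- Permutations σ of [n] with maxdrop σ ≤ 1 are exactly the concatenations of blocks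
--   (i)   or   (b, i, i+1, …, b−1)  with b > i,
-- laid on consecutive intervals [i, b] of positions; each block of the second kind
-- contributes exactly one descent, and such permutations automatically avoid 231.
-- A block decomposition is a composition of n, so there are 2^(n−1) of them, and
-- those with r blocks of length ≥ 2 are counted by C(n, 2r).
--
-- Counting successful
-- parses by their first letter gives the recursion F(m+1) = F(m) + ∑_{j<m} F′(j),
-- solved by 2^m and C(m, 2r).

open import Defs
open import Level using (0ℓ)
open import Function using (_∘_; id)
open import Function.Bundles using (_⇔_; mk⇔; Equivalence)
open import Data.Empty using (⊥-elim)
open import Data.Unit using (tt)
open import Data.Bool using (Bool; true; false; if_then_else_; T)
open import Data.Bool.Properties using (T-≡)
open import Data.Product using (_×_; _,_; proj₁; proj₂; ∃-syntax; map; map₂)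
open import Data.Sum using ([_,_]′; inj₁; inj₂)
open import Data.Maybe as Maybe using (Maybe; just; nothing)
open import Data.Nat using (ℕ; zero; suc; _+_; _*_; _^_; _∸_; _≤_; _<_; _≟_; _<?_; _≤?_; _≡ᵇ_; z≤n; z<s; s≤s; s≤s⁻¹)
open import Data.Nat.Properties
open import Data.Nat.Combinatorics using (_C_; nCk+nC[k+1]≡[n+1]C[k+1])
open import Data.Nat.Combinatorics.Specification using (k>n⇒nCk≡0)
open import Data.Nat.ListAction using (sum)
open import Data.Nat.ListAction.Properties using (sum-++)
open import Data.Fin using (Fin; toℕ; fromℕ<) renaming (zero to fzero; suc to fsuc; _<_ to _<ᶠ_)
open import Data.Fin.Base using (punchOut)
open import Data.Fin.Properties using (toℕ<n; toℕ-fromℕ<; toℕ-injective; any?; punchOut-injective; injective⇒≤)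
  renaming (_≟_ to _≟ᶠ_)
open import Data.Vec using (Vec; []; _∷_; lookup)
open import Data.Vec.Relation.Unary.All as All using (All; []; _∷_)
open import Data.Vec.Relation.Unary.All.Properties using (lookup⁺)
open import Data.List as List using ([]; _∷_; _++_; concatMap; tabulate; allFin; filter; length)
open import Data.List.Properties using (map-tabulate; map-++; map-∘; map-cong)
open import Relation.Nullary using (¬_; yes; no)
open import Relation.Nullary.Decidable using (_×-dec_; dec-false; dec-true; isYes≗does)
open import Relation.Unary using (Pred; Decidable)
open import Relation.Binary.Definitions using (tri<; tri≈; tri>)
open import Relation.Binary.PropositionalEquality
open ≡-Reasoning

sumBelow : (ℕ → ℕ) → ℕ → ℕ
sumBelow h zero    = 0
sumBelow h (suc N) = h 0 + sumBelow (h ∘ suc) N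

sumBelow-cong : ∀ {h h′} N → (∀ m → m < N → h m ≡ h′ m) → sumBelow h N ≡ sumBelow h′ N
sumBelow-cong zero    eq = refl
sumBelow-cong (suc N) eq = cong₂ _+_ (eq 0 z<s) (sumBelow-cong N (λ m m<N → eq (suc m) (s≤s m<N)))

sumBelow-zero : ∀ {h} N → (∀ m → m < N → h m ≡ 0) → sumBelow h N ≡ 0
sumBelow-zero zero    eq = refl
sumBelow-zero (suc N) eq = cong₂ _+_ (eq 0 z<s) (sumBelow-zero N (λ m m<N → eq (suc m) (s≤s m<N)))

sumBelow-snoc : ∀ h N → sumBelow h (suc N) ≡ sumBelow h N + h N
sumBelow-snoc h zero    = +-comm (h 0) 0
sumBelow-snoc h (suc N) = trans (cong (h 0 +_) (sumBelow-snoc (h ∘ suc) N)) (sym (+-assoc (h 0) _ _))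

sumBelow-from : ∀ {h} i c → (∀ m → m < i → h m ≡ 0) →
  sumBelow h (i + suc c) ≡ h i + sumBelow (λ d → h (i + suc d)) c
sumBelow-from zero    c vanish = refl
sumBelow-from {h} (suc i) c vanish =
  trans (cong (_+ sumBelow (h ∘ suc) (i + suc c)) (vanish 0 z<s))
        (sumBelow-from {h ∘ suc} i c (λ m m<i → vanish (suc m) (s≤s m<i)))

sumBelow-single : ∀ {h e} N → e < N → (∀ m → m ≢ e → h m ≡ 0) → sumBelow h N ≡ h e
sumBelow-single {h} {zero} (suc N) _ vanish =
  trans (cong (h 0 +_) (sumBelow-zero N (λ m _ → vanish (suc m) (λ ())))) (+-identityʳ (h 0))
sumBelow-single {h} {suc e} (suc N) (s≤s e<N) vanish =
  trans (cong (_+ sumBelow (h ∘ suc) N) (vanish 0 (λ ())))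
        (sumBelow-single {h ∘ suc} N e<N (λ m m≢e → vanish (suc m) (m≢e ∘ suc-injective)))

sumBelow-reverse : ∀ h N → sumBelow (λ d → h (N ∸ suc d)) N ≡ sumBelow h N
sumBelow-reverse h zero    = refl
sumBelow-reverse h (suc N) =
  trans (cong (h N +_) (sumBelow-reverse h N)) (trans (+-comm (h N) _) (sym (sumBelow-snoc h N)))

sum-allFin : ∀ N (h : ℕ → ℕ) → sum (List.map (h ∘ toℕ) (allFin N)) ≡ sumBelow h N
sum-allFin N h = trans (cong sum (map-tabulate {n = N} id (h ∘ toℕ))) (sum-tabulate N h)
  where
  sum-tabulate : ∀ N (h : ℕ → ℕ) → sum (tabulate {n = N} (h ∘ toℕ)) ≡ sumBelow h N
  sum-tabulate zero    h = refl
  sum-tabulate (suc N) h = cong (h 0 +_) (sum-tabulate N (h ∘ suc))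

sum-allWords-suc : ∀ n k (f : Vec (Fin n) (suc k) → ℕ) →
  sum (List.map f (allWords n (suc k))) ≡
  sum (List.map (λ x → sum (List.map (λ w → f (x ∷ w)) (allWords n k))) (allFin n))
sum-allWords-suc n k f = by-first-letter (allFin n)
  where
  by-first-letter : ∀ xs → sum (List.map f (concatMap (λ x → List.map (x ∷_) (allWords n k)) xs)) ≡
                           sum (List.map (λ x → sum (List.map (λ w → f (x ∷ w)) (allWords n k))) xs)
  by-first-letter []       = refl
  by-first-letter (x ∷ xs) = begin
    sum (List.map f (List.map (x ∷_) Ws ++ rest))
      ≡⟨ cong sum (map-++ f (List.map (x ∷_) Ws) rest) ⟩
    sum (List.map f (List.map (x ∷_) Ws) ++ List.map f rest)
      ≡⟨ sum-++ (List.map f (List.map (x ∷_) Ws)) (List.map f rest) ⟩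
    sum (List.map f (List.map (x ∷_) Ws)) + sum (List.map f rest)
      ≡⟨ cong₂ _+_ (cong sum (sym (map-∘ Ws))) (by-first-letter xs) ⟩
    sum (List.map (λ w → f (x ∷ w)) Ws) + sum (List.map (λ x → sum (List.map (λ w → f (x ∷ w)) Ws)) xs) ∎
    where
    Ws = allWords n k
    rest = concatMap (λ x → List.map (x ∷_) Ws) xs

sum-zero : ∀ {A : Set} (f : A → ℕ) → (∀ x → f x ≡ 0) → ∀ xs → sum (List.map f xs) ≡ 0
sum-zero f vanish []       = refl
sum-zero f vanish (x ∷ xs) = cong₂ _+_ (vanish x) (sum-zero f vanish xs)

hockey-stick : ∀ k m → sumBelow (_C k) m ≡ m C suc k
hockey-stick k zero    = refl
hockey-stick k (suc m) = begin
  sumBelow (_C k) (suc m)    ≡⟨ sumBelow-snoc (_C k) m ⟩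
  sumBelow (_C k) m + m C k  ≡⟨ cong (_+ m C k) (hockey-stick k m) ⟩
  m C suc k + m C k          ≡⟨ +-comm (m C suc k) (m C k) ⟩
  m C k + m C suc k          ≡⟨ nCk+nC[k+1]≡[n+1]C[k+1] m k ⟩
  suc m C suc k              ∎

count-filter : ∀ {A : Set} {P Q : Pred A 0ℓ} (P? : Decidable P) (Q? : Decidable Q) (f : A → ℕ) →
  (∀ x → P x → Q x → f x ≡ 1) → (∀ x → ¬ (P x × Q x) → f x ≡ 0) →
  ∀ xs → length (filter Q? (filter P? xs)) ≡ sum (List.map f xs)
count-filter P? Q? f one none [] = refl
count-filter P? Q? f one none (x ∷ xs) with P? x
... | no ¬p = trans (count-filter P? Q? f one none xs) (cong (_+ sum (List.map f xs)) (sym (none x (¬p ∘ proj₁))))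
... | yes p with Q? x
...   | yes q = trans (cong suc (count-filter P? Q? f one none xs)) (cong (_+ sum (List.map f xs)) (sym (one x p q)))
...   | no ¬q = trans (count-filter P? Q? f one none xs) (cong (_+ sum (List.map f xs)) (sym (none x (¬q ∘ proj₂))))

injective-onto : ∀ {m} (f : Fin m → Fin m) → (∀ {i j} → f i ≡ f j → i ≡ j) → ∀ v → ∃[ i ] f i ≡ v
injective-onto {m} f inj v with any? (λ i → f i ≟ᶠ v)
... | yes hit = hit
injective-onto {suc m} f inj v | no miss =
  ⊥-elim (1+n≰n (injective⇒≤ {f = f-avoiding-v} (λ eq → inj (punchOut-injective (≢v _) (≢v _) eq))))
  where
  ≢v : ∀ i → v ≢ f i
  ≢v i v≡fi = miss (i , sym v≡fi)
  f-avoiding-v : Fin (suc m) → Fin m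
  f-avoiding-v i = punchOut (≢v i)

module BlockWords (n : ℕ) where

  Word : ℕ → Set
  Word k = Vec (Fin n) k

  -- State `free i` (at position i, all values below i used): the next
  -- letter is i, a fixed point, or some b > i, the top of a new block.  State
  -- `block e b` (inside a block with top b): the next letter must be e, and the block
  -- closes after b − 1.  On success the result is the number of blocks of length ≥ 2.
  mutual
    free : ℕ → ∀ {k} → Word k → Maybe ℕ
    free i [] = just 0
    free i (x ∷ w) = freeStep i (toℕ x) w

    freeStep : ℕ → ℕ → ∀ {k} → Word k → Maybe ℕ
    freeStep i m w with <-cmp m i
    ... | tri< _ _ _ = nothing
    ... | tri≈ _ _ _ = free (suc i) w
    ... | tri> _ _ _ = Maybe.map suc (block i m w)

    block : ℕ → ℕ → ∀ {k} → Word k → Maybe ℕ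
    block e b [] = nothing
    block e b (x ∷ w) = blockStep e b (toℕ x) w

    blockStep : ℕ → ℕ → ℕ → ∀ {k} → Word k → Maybe ℕ
    blockStep e b m w with m ≟ e | suc e ≟ b
    ... | no _  | _     = nothing
    ... | yes _ | yes _ = free (suc b) w
    ... | yes _ | no _  = block (suc e) b w

  mutual
    data Free (i : ℕ) : ∀ {k} → Word k → ℕ → Set where
      done  : Free i [] 0
      fixed : ∀ {k x c} {w : Word k} → toℕ x ≡ i → Free (suc i) w c → Free i (x ∷ w) c
      opens : ∀ {k x c} {w : Word k} → i < toℕ x → Block i (toℕ x) w c → Free i (x ∷ w) (suc c)

    data Block (e b : ℕ) : ∀ {k} → Word k → ℕ → Set where
      closes    : ∀ {k x c} {w : Word k} → toℕ x ≡ e → suc e ≡ b → Free (suc b) w c → Block e b (x ∷ w) c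
      continues : ∀ {k x c} {w : Word k} → toℕ x ≡ e → suc e ≢ b → Block (suc e) b w c → Block e b (x ∷ w) c

  freeStep-below : ∀ {i m k} (w : Word k) → m < i → freeStep i m w ≡ nothing
  freeStep-below {i} {m} w m<i with <-cmp m i
  ... | tri< _ _ _ = refl
  ... | tri≈ _ m≡i _ = ⊥-elim (<-irrefl m≡i m<i)
  ... | tri> _ _ i<m = ⊥-elim (<-asym m<i i<m)

  freeStep-fixed : ∀ {i k} (w : Word k) → freeStep i i w ≡ free (suc i) w
  freeStep-fixed {i} w with <-cmp i i
  ... | tri< i<i _ _ = ⊥-elim (<-irrefl refl i<i)
  ... | tri≈ _ _ _ = refl
  ... | tri> _ _ i<i = ⊥-elim (<-irrefl refl i<i)

  freeStep-opens : ∀ {i m k} (w : Word k) → i < m → freeStep i m w ≡ Maybe.map suc (block i m w)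
  freeStep-opens {i} {m} w i<m with <-cmp m i
  ... | tri< m<i _ _ = ⊥-elim (<-asym m<i i<m)
  ... | tri≈ _ m≡i _ = ⊥-elim (<-irrefl (sym m≡i) i<m)
  ... | tri> _ _ _ = refl

  blockStep-wrong : ∀ {e b m k} (w : Word k) → m ≢ e → blockStep e b m w ≡ nothing
  blockStep-wrong {e} {b} {m} w m≢e with m ≟ e | suc e ≟ b
  ... | no _  | _ = refl
  ... | yes m≡e | _ = ⊥-elim (m≢e m≡e)

  blockStep-closes : ∀ {e b k} (w : Word k) → suc e ≡ b → blockStep e b e w ≡ free (suc b) w
  blockStep-closes {e} {b} w 1+e≡b with e ≟ e | suc e ≟ b
  ... | no e≢e | _ = ⊥-elim (e≢e refl)
  ... | yes _ | yes _ = refl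
  ... | yes _ | no 1+e≢b = ⊥-elim (1+e≢b 1+e≡b)

  blockStep-continues : ∀ {e b k} (w : Word k) → suc e ≢ b → blockStep e b e w ≡ block (suc e) b w
  blockStep-continues {e} {b} w 1+e≢b with e ≟ e | suc e ≟ b
  ... | no e≢e | _ = ⊥-elim (e≢e refl)
  ... | yes _ | yes 1+e≡b = ⊥-elim (1+e≢b 1+e≡b)
  ... | yes _ | no _ = refl

  mutual
    free⇒Free : ∀ {i k c} (w : Word k) → free i w ≡ just c → Free i w c
    free⇒Free [] refl = done
    free⇒Free {i} (x ∷ w) h with <-cmp (toℕ x) i
    ... | tri≈ _ x≡i _ = fixed x≡i (free⇒Free w h)
    ... | tri> _ _ i<x with block i (toℕ x) w in eq
    ...   | just c' with refl ← h = opens i<x (block⇒Block w eq)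

    block⇒Block : ∀ {e b k c} (w : Word k) → block e b w ≡ just c → Block e b w c
    block⇒Block {e} {b} (x ∷ w) h with toℕ x ≟ e | suc e ≟ b
    ... | yes x≡e | yes 1+e≡b = closes x≡e 1+e≡b (free⇒Free w h)
    ... | yes x≡e | no 1+e≢b = continues x≡e 1+e≢b (block⇒Block w h)

  mutual
    Free⇒free : ∀ {i k c} {w : Word k} → Free i w c → free i w ≡ just c
    Free⇒free done = refl
    Free⇒free {i} {w = x ∷ w} (fixed x≡i rest) =
      trans (cong (λ m → freeStep i m w) x≡i) (trans (freeStep-fixed w) (Free⇒free rest))
    Free⇒free {w = x ∷ w} (opens i<x rest) =
      trans (freeStep-opens w i<x) (cong (Maybe.map suc) (Block⇒block rest))

    Block⇒block : ∀ {e b k c} {w : Word k} → Block e b w c → block e b w ≡ just c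
    Block⇒block {e} {b} {w = x ∷ w} (closes x≡e 1+e≡b rest) =
      trans (cong (λ m → blockStep e b m w) x≡e) (trans (blockStep-closes w 1+e≡b) (Free⇒free rest))
    Block⇒block {e} {b} {w = x ∷ w} (continues x≡e 1+e≢b rest) =
      trans (cong (λ m → blockStep e b m w) x≡e) (trans (blockStep-continues w 1+e≢b) (Block⇒block rest))

  Block-top : ∀ {e b k c} {w : Word k} → Block e b w c → e < b
  Block-top (closes _ 1+e≡b _) = ≤-reflexive 1+e≡b
  Block-top (continues _ _ rest) = <-trans (n<1+n _) (Block-top rest)

  Block-head : ∀ {e b k c x} {w : Word k} → Block e b (x ∷ w) c → toℕ x ≡ e
  Block-head (closes x≡e _ _) = x≡e
  Block-head (continues x≡e _ _) = x≡e

  Block-head<top : ∀ {e b k c x} {w : Word k} → Block e b (x ∷ w) c → toℕ x < b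
  Block-head<top blk = subst (_< _) (sym (Block-head blk)) (Block-top blk)

  head-bounds : ∀ {e b k c x} {w : Word k} → Block e b (x ∷ w) c → e ≤ toℕ x × toℕ x ≢ b
  head-bounds blk = ≤-reflexive (sym (Block-head blk)) , <⇒≢ (Block-head<top blk)

  mutual
    Free-above : ∀ {i k c} {w : Word k} → Free i w c → All (λ y → i ≤ toℕ y) w
    Free-above done = []
    Free-above (fixed x≡i rest) = ≤-reflexive (sym x≡i) ∷ All.map <⇒≤ (Free-above rest)
    Free-above (opens i<x rest) = <⇒≤ i<x ∷ All.map proj₁ (Block-above rest)

    Block-above : ∀ {e b k c} {w : Word k} → Block e b w c → All (λ y → e ≤ toℕ y × toℕ y ≢ b) w
    Block-above blk@(closes _ _ rest) =
      head-bounds blk ∷ All.map (λ b<y → <⇒≤ (<-trans (Block-top blk) b<y) , >⇒≢ b<y) (Free-above rest)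
    Block-above blk@(continues _ _ rest) =
      head-bounds blk ∷ All.map (λ { (e<y , y≢b) → <⇒≤ e<y , y≢b }) (Block-above rest)

  Fixed-later : ∀ {i k c} {x : Fin n} {w : Word k} → toℕ x ≡ i → Free (suc i) w c →
    All (λ y → toℕ x < toℕ y) w
  Fixed-later x≡i rest = All.map (subst (_< _) (sym x≡i)) (Free-above rest)

  Block-later : ∀ {e b k c x} {w : Word k} → Block e b (x ∷ w) c → All (λ y → toℕ x < toℕ y) w
  Block-later blk@(closes x≡e _ rest) =
    All.map (λ b<y → subst (_< _) (sym x≡e) (<-trans (Block-top blk) b<y)) (Free-above rest)
  Block-later (continues x≡e _ rest) =
    All.map (λ bounds → subst (_< _) (sym x≡e) (proj₁ bounds)) (Block-above rest)

  Distinct : ∀ {k} → Word k → Set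
  Distinct {k} w = ∀ (p q : Fin k) → lookup w p ≡ lookup w q → p ≡ q

  distinct-∷ : ∀ {k} {x : Fin n} {w : Word k} → All (λ y → toℕ y ≢ toℕ x) w →
    Distinct w → Distinct (x ∷ w)
  distinct-∷ fresh distinct fzero    fzero    _      = refl
  distinct-∷ fresh distinct fzero    (fsuc q) x≡w[q] = ⊥-elim (lookup⁺ fresh q (cong toℕ (sym x≡w[q])))
  distinct-∷ fresh distinct (fsuc p) fzero    w[p]≡x = ⊥-elim (lookup⁺ fresh p (cong toℕ w[p]≡x))
  distinct-∷ fresh distinct (fsuc p) (fsuc q) eq     = cong fsuc (distinct p q eq)

  mutual
    Free-distinct : ∀ {i k c} {w : Word k} → Free i w c → Distinct w
    Free-distinct done = λ ()
    Free-distinct (fixed x≡i rest) = distinct-∷ (All.map >⇒≢ (Fixed-later x≡i rest)) (Free-distinct rest)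
    Free-distinct (opens _ rest) = distinct-∷ (All.map proj₂ (Block-above rest)) (Block-distinct rest)

    Block-distinct : ∀ {e b k c} {w : Word k} → Block e b w c → Distinct w
    Block-distinct blk@(closes _ _ rest) = distinct-∷ (All.map >⇒≢ (Block-later blk)) (Free-distinct rest)
    Block-distinct blk@(continues _ _ rest) = distinct-∷ (All.map >⇒≢ (Block-later blk)) (Block-distinct rest)

  Avoids : ∀ {k} → Word k → Set
  Avoids {k} w = ∀ (a b c : Fin k) → a <ᶠ b → b <ᶠ c →
    ¬ (lookup w c <ᶠ lookup w a × lookup w a <ᶠ lookup w b)

  avoids-∷ : ∀ {k} {x : Fin n} {w : Word k} →
    (∀ (b c : Fin k) → b <ᶠ c → ¬ (lookup w c <ᶠ x × x <ᶠ lookup w b)) → Avoids w → Avoids (x ∷ w)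
  avoids-∷ head tail fzero    (fsuc b) (fsuc c) _         (s≤s b<c) = head b c b<c
  avoids-∷ head tail (fsuc a) (fsuc b) (fsuc c) (s≤s a<b) (s≤s b<c) = tail a b c a<b b<c

  smallest-head : ∀ {k} {x : Fin n} {w : Word k} → All (λ y → toℕ x < toℕ y) w →
    ∀ (b c : Fin k) → b <ᶠ c → ¬ (lookup w c <ᶠ x × x <ᶠ lookup w b)
  smallest-head later b c _ (w[c]<x , _) = <-asym w[c]<x (lookup⁺ later c)

  Block-persist : ∀ {e b k c} {w : Word k} → Block e b w c →
    ∀ (p q : Fin k) → p <ᶠ q → b < toℕ (lookup w p) → b < toℕ (lookup w q)
  Block-persist blk@(closes _ _ _)    fzero q _ b<x = ⊥-elim (<-asym b<x (Block-head<top blk))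
  Block-persist blk@(continues _ _ _) fzero q _ b<x = ⊥-elim (<-asym b<x (Block-head<top blk))
  Block-persist (closes _ _ rest) (fsuc p) (fsuc q) _ _ = lookup⁺ (Free-above rest) q
  Block-persist (continues _ _ rest) (fsuc p) (fsuc q) (s≤s p<q) b<w[p] = Block-persist rest p q p<q b<w[p]

  mutual
    Free-avoids : ∀ {i k c} {w : Word k} → Free i w c → Avoids w
    Free-avoids done = λ ()
    Free-avoids (fixed x≡i rest) = avoids-∷ (smallest-head (Fixed-later x≡i rest)) (Free-avoids rest)
    Free-avoids (opens _ rest) =
      avoids-∷ (λ b c b<c (w[c]<x , x<w[b]) → <-asym w[c]<x (Block-persist rest b c b<c x<w[b])) (Block-avoids rest)

    Block-avoids : ∀ {e b k c} {w : Word k} → Block e b w c → Avoids w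
    Block-avoids blk@(closes _ _ rest) = avoids-∷ (smallest-head (Block-later blk)) (Free-avoids rest)
    Block-avoids blk@(continues _ _ rest) = avoids-∷ (smallest-head (Block-later blk)) (Block-avoids rest)

  drop≤1 : ∀ {i x} → i ≤ suc x → i ∸ x ≤ 1
  drop≤1 {i} {x} i≤1+x = ≤-trans (∸-monoˡ-≤ x i≤1+x) (≤-reflexive (m+n∸n≡m 1 x))

  -- State `free i` is entered at position i, state `block e b` at position e + 1.
  mutual
    Free-maxdrop : ∀ {i k c} {w : Word k} → Free i w c → maxdropFrom i w ≤ 1
    Free-maxdrop done = z≤n
    Free-maxdrop (fixed x≡i rest) =
      ⊔-lub (drop≤1 (≤-trans (≤-reflexive (sym x≡i)) (n≤1+n _))) (Free-maxdrop rest)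
    Free-maxdrop (opens i<x rest) = ⊔-lub (drop≤1 (≤-trans (<⇒≤ i<x) (n≤1+n _))) (Block-maxdrop rest)

    Block-maxdrop : ∀ {e b k c} {w : Word k} → Block e b w c → maxdropFrom (suc e) w ≤ 1
    Block-maxdrop {w = _ ∷ w} (closes x≡e 1+e≡b rest) =
      ⊔-lub (drop≤1 (s≤s (≤-reflexive (sym x≡e))))
            (subst (λ t → maxdropFrom (suc t) w ≤ 1) (sym 1+e≡b) (Free-maxdrop rest))
    Block-maxdrop (continues x≡e _ rest) = ⊔-lub (drop≤1 (s≤s (≤-reflexive (sym x≡e)))) (Block-maxdrop rest)

  desFrom-no-descent : ∀ {k} {y : Fin n} {w : Word k} → All (λ z → toℕ y ≤ toℕ z) w →
    desFrom y w ≡ desL w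
  desFrom-no-descent [] = refl
  desFrom-no-descent {y = y} {w = z ∷ w} (y≤z ∷ _) =
    cong (λ t → (if t then 1 else 0) + desFrom z w)
         (trans (isYes≗does (toℕ z <? toℕ y)) (dec-false (toℕ z <? toℕ y) (≤⇒≯ y≤z)))

  Block-entry-descent : ∀ {e b k c} {y : Fin n} {w : Word k} → Block e b w c → e < toℕ y →
    desFrom y w ≡ suc (desL w)
  Block-entry-descent {y = y} {w = x ∷ w} blk e<y =
    cong (λ t → (if t then 1 else 0) + desFrom x w)
         (trans (isYes≗does (toℕ x <? toℕ y)) (dec-true (toℕ x <? toℕ y) x<y))
    where x<y = subst (_< toℕ y) (sym (Block-head blk)) e<y

  mutual
    Free-des : ∀ {i k c} {w : Word k} → Free i w c → desL w ≡ c
    Free-des done = refl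
    Free-des (fixed x≡i rest) = trans (desFrom-no-descent (All.map <⇒≤ (Fixed-later x≡i rest))) (Free-des rest)
    Free-des (opens i<x rest) = trans (Block-entry-descent rest i<x) (cong suc (Block-des rest))

    Block-des : ∀ {e b k c} {w : Word k} → Block e b w c → desL w ≡ c
    Block-des blk@(closes _ _ rest) = trans (desFrom-no-descent (All.map <⇒≤ (Block-later blk))) (Free-des rest)
    Block-des blk@(continues _ _ rest) = trans (desFrom-no-descent (All.map <⇒≤ (Block-later blk))) (Block-des rest)

  parse-sound : ∀ (σ : Word n) {c} → free 0 σ ≡ just c →
    (IsPerm σ × Avoids231 σ) × maxdrop σ ≤ 1 × des σ ≡ c
  parse-sound σ parsed = (Free-distinct F , Free-avoids F) , Free-maxdrop F , Free-des F
    where F = free⇒Free σ parsed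

  -- The value at a natural-number position (0 past the end).
  at : ∀ {k} → Word k → ℕ → ℕ
  at []      p       = 0
  at (x ∷ w) zero    = toℕ x
  at (x ∷ w) (suc p) = at w p

  at-lookup : ∀ {k} (w : Word k) (p : Fin k) → at w (toℕ p) ≡ toℕ (lookup w p)
  at-lookup (x ∷ w) fzero    = refl
  at-lookup (x ∷ w) (fsuc p) = at-lookup w p

  at-fromℕ< : ∀ {k} (w : Word k) {p} (p<k : p < k) → at w p ≡ toℕ (lookup w (fromℕ< p<k))
  at-fromℕ< w {p} p<k = trans (cong (at w) (sym (toℕ-fromℕ< p<k))) (at-lookup w (fromℕ< p<k))

  at-maxdrop : ∀ {i k} (w : Word k) → maxdropFrom i w ≤ 1 → ∀ p → p < k → i + p ≤ suc (at w p)
  at-maxdrop {i} (x ∷ w) md zero _ =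
    subst (_≤ suc (toℕ x)) (sym (+-identityʳ i)) (undrop (≤-trans (m≤m⊔n _ _) md))
    where
    undrop : i ∸ toℕ x ≤ 1 → i ≤ suc (toℕ x)
    undrop le = subst (i ≤_) (+-comm (toℕ x) 1) (≤-trans (m≤n+m∸n i (toℕ x)) (+-monoʳ-≤ (toℕ x) le))
  at-maxdrop {i} (x ∷ w) md (suc p) (s≤s p<k) =
    subst (_≤ suc (at w p)) (sym (+-suc i p)) (at-maxdrop w (≤-trans (m≤n⊔m _ _) md) p p<k)

  -- Completeness: the one-line notation of a permutation with maxdrop ≤ 1 parses.
  -- Reading σ from left to right, positions below i₀ always hold exactly the values below i₀.
  module Completeness (σ : Word n) (distinct : Distinct σ) (md : maxdrop σ ≤ 1) where

    π : ℕ → ℕ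
    π = at σ

    π-injective : ∀ {p q} → p < n → q < n → π p ≡ π q → p ≡ q
    π-injective {p} {q} p<n q<n eq =
      trans (sym (toℕ-fromℕ< p<n)) (trans (cong toℕ (distinct _ _ (toℕ-injective lookups≡))) (toℕ-fromℕ< q<n))
      where
      lookups≡ = trans (sym (at-fromℕ< σ p<n)) (trans eq (at-fromℕ< σ q<n))

    π-onto : ∀ {v} → v < n → ∃[ p ] p < n × π p ≡ v
    π-onto {v} v<n with injective-onto (lookup σ) (λ {p} {q} → distinct p q) (fromℕ< v<n)
    ... | p , σp≡v = toℕ p , toℕ<n p , trans (at-lookup σ p) (trans (cong toℕ σp≡v) (toℕ-fromℕ< v<n))

    π-drop : ∀ {p} → p < n → p ≤ suc (π p)
    π-drop p<n = at-maxdrop σ md _ p<n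

    Suffix : ∀ {k} → ℕ → Word k → Set
    Suffix i w = ∀ p → π (i + p) ≡ at w p

    suffix-head : ∀ {i k} {x : Fin n} {w : Word k} → Suffix i (x ∷ w) → toℕ x ≡ π i
    suffix-head {i} suf = sym (trans (cong π (sym (+-identityʳ i))) (suf 0))

    suffix-tail : ∀ {i k} {x : Fin n} {w : Word k} → Suffix i (x ∷ w) → Suffix (suc i) w
    suffix-tail {i} suf p = trans (cong π (sym (+-suc i p))) (suf (suc p))

    record FreeInv (i : ℕ) : Set where
      field
        below    : ∀ r → r < i → π r < i
        previous : ∀ j → i ≡ suc j → ∃[ r ] r < i × π r ≡ j

    record BlockInv (i₀ e b : ℕ) : Set where
      field
        start≤e : i₀ ≤ e
        top     : π i₀ ≡ b
        e<b     : e < b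
        b<n     : b < n
        below   : ∀ r → r < i₀ → π r < i₀
        run     : ∀ r → i₀ < r → r ≤ e → suc (π r) ≡ r

    -- In state `free i` the next value is not below i: it could only be i − 1, which is used.
    free-next : ∀ {i} → FreeInv i → i < n → i ≤ π i
    free-next {i} inv i<n with i ≤? π i
    ... | yes i≤πi = i≤πi
    ... | no i≰πi = ⊥-elim (<-irrefl r≡i r<i)
      where
      i≡1+πi = ≤-antisym (π-drop i<n) (≰⇒> i≰πi)
      r = proj₁ (FreeInv.previous inv (π i) i≡1+πi)
      r<i = proj₁ (proj₂ (FreeInv.previous inv (π i) i≡1+πi))
      r≡i = π-injective (<-trans r<i i<n) i<n (proj₂ (proj₂ (FreeInv.previous inv (π i) i≡1+πi)))

    -- In state `block e b` the next value is e: by maxdrop, e sits at a position ≤ e + 1,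
    -- and every other such position is already occupied.
    block-next : ∀ {i₀ e b} → BlockInv i₀ e b → π (suc e) ≡ e
    block-next {i₀} {e} {b} inv with π-onto (<-trans (BlockInv.e<b inv) (BlockInv.b<n inv))
    ... | s , s<n , πs≡e = trans (cong π (sym (position-of-e s<n πs≡e))) πs≡e
      where
      open BlockInv inv
      position-of-e : ∀ {s} → s < n → π s ≡ e → s ≡ suc e
      position-of-e {s} s<n πs≡e with <-cmp s i₀
      ... | tri< s<i₀ _ _ = ⊥-elim (<⇒≱ (subst (_< i₀) πs≡e (below s s<i₀)) start≤e)
      ... | tri≈ _ s≡i₀ _ = ⊥-elim (<⇒≢ e<b (trans (sym πs≡e) (trans (cong π s≡i₀) top)))
      ... | tri> _ _ i₀<s with s ≤? e
      ...   | yes s≤e = ⊥-elim (<⇒≱ (≤-reflexive (trans (cong suc (sym πs≡e)) (run s i₀<s s≤e))) s≤e)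
      ...   | no s≰e = ≤-antisym (subst (λ v → s ≤ suc v) πs≡e (π-drop s<n)) (≰⇒> s≰e)

    free-fixed : ∀ {i} → FreeInv i → π i ≡ i → FreeInv (suc i)
    free-fixed {i} inv πi≡i = record
      { below    = λ r r<1+i → [ (λ r<i → m<n⇒m<1+n (FreeInv.below inv r r<i))
                               , (λ r≡i → s≤s (≤-reflexive (trans (cong π r≡i) πi≡i))) ]′
                               (m≤n⇒m<n∨m≡n (s≤s⁻¹ r<1+i))
      ; previous = λ j 1+i≡1+j → i , ≤-refl , trans πi≡i (suc-injective 1+i≡1+j)
      }

    free-opens : ∀ {i} → FreeInv i → i < π i → π i < n → BlockInv i i (π i)
    free-opens inv i<πi πi<n = record
      { start≤e = ≤-refl ; top = refl ; e<b = i<πi ; b<n = πi<n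
      ; below = FreeInv.below inv ; run = λ r i<r r≤i → ⊥-elim (<⇒≱ i<r r≤i) }

    block-closes : ∀ {i₀ e b} → BlockInv i₀ e b → suc e ≡ b → FreeInv (suc b)
    block-closes {i₀} {e} {b} inv 1+e≡b = record
      { below    = below′
      ; previous = λ j 1+b≡1+j → i₀ , s≤s (≤-trans start≤e (<⇒≤ e<b)) , trans top (suc-injective 1+b≡1+j)
      }
      where
      open BlockInv inv
      below′ : ∀ r → r < suc b → π r < suc b
      below′ r r<1+b with <-cmp r i₀
      ... | tri< r<i₀ _ _ = m<n⇒m<1+n (<-≤-trans (below r r<i₀) (≤-trans start≤e (<⇒≤ e<b)))
      ... | tri≈ _ r≡i₀ _ = s≤s (≤-reflexive (trans (cong π r≡i₀) top))
      ... | tri> _ _ i₀<r with r ≤? e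
      ...   | yes r≤e = subst (_≤ suc b) (sym (run r i₀<r r≤e)) (≤-trans r≤e (m<n⇒m≤1+n e<b))
      ...   | no r≰e =
        subst (λ p → π p < suc b) (sym r≡1+e) (s≤s (≤-trans (≤-reflexive (block-next inv)) (<⇒≤ e<b)))
        where r≡1+e = ≤-antisym (≤-trans (s≤s⁻¹ r<1+b) (≤-reflexive (sym 1+e≡b))) (≰⇒> r≰e)

    block-continues : ∀ {i₀ e b} → BlockInv i₀ e b → suc e ≢ b → BlockInv i₀ (suc e) b
    block-continues {i₀} {e} {b} inv 1+e≢b = record
      { start≤e = m≤n⇒m≤1+n start≤e ; top = top ; e<b = ≤∧≢⇒< e<b 1+e≢b ; b<n = b<n ; below = below
      ; run = λ r i₀<r r≤1+e → [ (λ r<1+e → run r i₀<r (s≤s⁻¹ r<1+e))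
                               , (λ r≡1+e → trans (cong (suc ∘ π) r≡1+e)
                                                  (trans (cong suc (block-next inv)) (sym r≡1+e))) ]′
                               (m≤n⇒m<n∨m≡n r≤1+e)
      }
      where open BlockInv inv

    mutual
      parse-free : ∀ {i k} (w : Word k) → Suffix i w → i + k ≡ n → FreeInv i → ∃[ c ] Free i w c
      parse-free [] _ _ _ = 0 , done
      parse-free {i} {suc k} (x ∷ w) suf len inv with m≤n⇒m<n∨m≡n (free-next inv i<n)
        where i<n = subst (i <_) len (m<m+n i z<s)
      ... | inj₂ i≡πi =
        map₂ (fixed (trans x≡πi (sym i≡πi)))
             (parse-free w (suffix-tail suf) (trans (sym (+-suc i k)) len) (free-fixed inv (sym i≡πi)))
        where x≡πi = suffix-head suf
      ... | inj₁ i<πi =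
        map suc (λ rest → opens (subst (i <_) (sym x≡πi) i<πi) (subst (λ b → Block i b w _) (sym x≡πi) rest))
            (parse-block w (suffix-tail suf) (trans (sym (+-suc i k)) len) (free-opens inv i<πi πi<n))
        where
        x≡πi = suffix-head suf
        πi<n = subst (_< n) x≡πi (toℕ<n x)

      parse-block : ∀ {i₀ e b k} (w : Word k) → Suffix (suc e) w → suc e + k ≡ n → BlockInv i₀ e b →
                    ∃[ c ] Block e b w c
      parse-block {e = e} [] _ len inv =
        ⊥-elim (<⇒≱ (BlockInv.e<b inv) (s≤s⁻¹ (≤-trans (BlockInv.b<n inv) (≤-reflexive n≡1+e))))
        where n≡1+e = trans (sym len) (+-identityʳ (suc e))
      parse-block {e = e} {b} {suc k} (x ∷ w) suf len inv with suc e ≟ b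
      ... | yes 1+e≡b =
        map₂ (closes x≡e 1+e≡b)
             (parse-free w (subst (λ t → Suffix (suc t) w) 1+e≡b (suffix-tail suf))
                           (subst (λ t → suc t + k ≡ n) 1+e≡b (trans (sym (+-suc (suc e) k)) len))
                           (block-closes inv 1+e≡b))
        where x≡e = trans (suffix-head suf) (block-next inv)
      ... | no 1+e≢b =
        map₂ (continues x≡e 1+e≢b)
             (parse-block w (suffix-tail suf) (trans (sym (+-suc (suc e) k)) len) (block-continues inv 1+e≢b))
        where x≡e = trans (suffix-head suf) (block-next inv)

    parses : ∃[ c ] Free 0 σ c
    parses = parse-free σ (λ p → refl) refl (record { below = λ _ () ; previous = λ _ () })

  parse-complete : ∀ (σ : Word n) → IsPerm σ → maxdrop σ ≤ 1 → free 0 σ ≡ just (des σ)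
  parse-complete σ perm md with Completeness.parses σ perm md
  ... | c , F = trans (Free⇒free F) (cong just (sym (Free-des F)))

  score : (ℕ → Bool) → Maybe ℕ → ℕ
  score g nothing  = 0
  score g (just c) = if g c then 1 else 0

  score-suc : ∀ g r → score g (Maybe.map suc r) ≡ score (g ∘ suc) r
  score-suc g nothing  = refl
  score-suc g (just c) = refl

  tally : (ℕ → Bool) → ∀ k → (Word k → Maybe ℕ) → ℕ
  tally g k parser = sum (List.map (score g ∘ parser) (allWords n k))

  tally-cong : ∀ g k {p q : Word k → Maybe ℕ} → (∀ w → p w ≡ q w) → tally g k p ≡ tally g k q
  tally-cong g k p≗q = cong sum (map-cong (cong (score g) ∘ p≗q) (allWords n k))

  tally-reject : ∀ g k {p : Word k → Maybe ℕ} → (∀ w → p w ≡ nothing) → tally g k p ≡ 0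
  tally-reject g k {p} rejects = sum-zero (score g ∘ p) (cong (score g) ∘ rejects) (allWords n k)

  tally-free-suc : ∀ g k i → tally g (suc k) (free i) ≡ sumBelow (λ m → tally g k (freeStep i m)) n
  tally-free-suc g k i =
    trans (sum-allWords-suc n k (score g ∘ free i)) (sum-allFin n (λ m → tally g k (freeStep i m)))

  tally-block-suc : ∀ g k e b → tally g (suc k) (block e b) ≡ sumBelow (λ m → tally g k (blockStep e b m)) n
  tally-block-suc g k e b =
    trans (sum-allWords-suc n k (score g ∘ block e b)) (sum-allFin n (λ m → tally g k (blockStep e b m)))

  tally-free-step : ∀ g k i → i + suc k ≡ n →
    tally g (suc k) (free i) ≡ tally g k (free (suc i)) + sumBelow (λ d → tally (g ∘ suc) k (block i (i + suc d))) k
  tally-free-step g k i len = begin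
    tally g (suc k) (free i)
      ≡⟨ tally-free-suc g k i ⟩
    sumBelow (λ m → tally g k (freeStep i m)) n
      ≡⟨ cong (sumBelow _) (sym len) ⟩
    sumBelow (λ m → tally g k (freeStep i m)) (i + suc k)
      ≡⟨ sumBelow-from i k (λ m m<i → tally-reject g k (λ w → freeStep-below w m<i)) ⟩
    tally g k (freeStep i i) + sumBelow (λ d → tally g k (freeStep i (i + suc d))) k
      ≡⟨ cong₂ _+_ (tally-cong g k freeStep-fixed) (sumBelow-cong k (λ d _ → opening d)) ⟩
    tally g k (free (suc i)) + sumBelow (λ d → tally (g ∘ suc) k (block i (i + suc d))) k ∎
    where
    opening : ∀ d → tally g k (freeStep i (i + suc d)) ≡ tally (g ∘ suc) k (block i (i + suc d))
    opening d = cong sum (map-cong (λ w → trans (cong (score g) (freeStep-opens w (m<m+n i z<s)))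
                                                (score-suc g (block i (i + suc d) w)))
                                   (allWords n k))

  tally-block-step : ∀ g k e b → e < n →
    tally g (suc k) (block e b) ≡ tally g k (blockStep e b e)
  tally-block-step g k e b e<n =
    trans (tally-block-suc g k e b)
          (sumBelow-single n e<n (λ m m≢e → tally-reject g k (λ w → blockStep-wrong w m≢e)))

  tally-block : ∀ g k e d → e + d < n →
    tally g (suc d + k) (block e (suc (e + d))) ≡ tally g k (free (suc (suc (e + d))))
  tally-block g k e zero e<n = begin
    tally g (suc k) (block e (suc (e + 0)))      ≡⟨ tally-block-step g k e _ (≤-trans (s≤s (m≤m+n e 0)) e<n) ⟩
    tally g k (blockStep e (suc (e + 0)) e)
      ≡⟨ tally-cong g k (λ w → blockStep-closes w (cong suc (sym (+-identityʳ e)))) ⟩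
    tally g k (free (suc (suc (e + 0))))         ∎
  tally-block g k e (suc d) e+d+1<n = begin
    tally g (suc (suc d) + k) (block e (suc (e + suc d)))
      ≡⟨ tally-block-step g (suc d + k) e _ (≤-trans (s≤s (m≤m+n e (suc d))) e+d+1<n) ⟩
    tally g (suc d + k) (blockStep e (suc (e + suc d)) e)
      ≡⟨ tally-cong g (suc d + k) (λ w → blockStep-continues w 1+e≢top) ⟩
    tally g (suc d + k) (block (suc e) (suc (e + suc d)))
      ≡⟨ cong (λ t → tally g (suc d + k) (block (suc e) (suc t))) (+-suc e d) ⟩
    tally g (suc d + k) (block (suc e) (suc (suc e + d)))
      ≡⟨ tally-block g k (suc e) d (subst (_< n) (+-suc e d) e+d+1<n) ⟩
    tally g k (free (suc (suc (suc e + d))))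
      ≡⟨ cong (λ t → tally g k (free (suc (suc t)))) (sym (+-suc e d)) ⟩
    tally g k (free (suc (suc (e + suc d))))   ∎
    where
    1+e≢top : suc e ≢ suc (e + suc d)
    1+e≢top eq = m≢1+m+n e (suc-injective (trans eq (cong suc (+-suc e d))))

  -- Parses of words of length m ≤ n (the last m letters of a word of length n).
  blockWords : (ℕ → Bool) → ℕ → ℕ
  blockWords g m = tally g m (free (n ∸ m))

  -- The first block is a fixed point or has length d + 2 for some d < m; in the latter
  -- case it contributes one descent, hence the shift g ∘ suc.
  blockWords-suc : ∀ g m → suc m ≤ n →
    blockWords g (suc m) ≡ blockWords g m + sumBelow (blockWords (g ∘ suc)) m
  blockWords-suc g m 1+m≤n = begin
    tally g (suc m) (free i)
      ≡⟨ tally-free-step g m i len ⟩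
    tally g m (free (suc i)) + sumBelow (λ d → tally (g ∘ suc) m (block i (i + suc d))) m
      ≡⟨ cong₂ _+_ (cong (λ j → tally g m (free j)) (sym (∸-from (trans (sym (+-suc i m)) len))))
                   (sumBelow-cong m first-block) ⟩
    blockWords g m + sumBelow (λ d → blockWords (g ∘ suc) (m ∸ suc d)) m
      ≡⟨ cong (blockWords g m +_) (sumBelow-reverse (blockWords (g ∘ suc)) m) ⟩
    blockWords g m + sumBelow (blockWords (g ∘ suc)) m ∎
    where
    i = n ∸ suc m
    len : i + suc m ≡ n
    len = m∸n+n≡m 1+m≤n

    ∸-from : ∀ {a t} → a + t ≡ n → n ∸ t ≡ a
    ∸-from {a} {t} a+t≡n = trans (cong (_∸ t) (sym a+t≡n)) (m+n∸n≡m a t)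

    first-block : ∀ d → d < m → tally (g ∘ suc) m (block i (i + suc d)) ≡ blockWords (g ∘ suc) (m ∸ suc d)
    first-block d d<m = begin
      tally (g ∘ suc) m (block i (i + suc d))
        ≡⟨ cong₂ (λ k b → tally (g ∘ suc) k (block i b)) (sym m≡) (+-suc i d) ⟩
      tally (g ∘ suc) (suc d + t) (block i (suc (i + d)))
        ≡⟨ tally-block (g ∘ suc) t i d i+d<n ⟩
      tally (g ∘ suc) t (free (suc (suc (i + d))))
        ≡⟨ cong (λ j → tally (g ∘ suc) t (free j)) (sym (∸-from len′)) ⟩
      blockWords (g ∘ suc) t ∎
      where
      t = m ∸ suc d
      m≡ : suc d + t ≡ m
      m≡ = m+[n∸m]≡n d<m
      i+d<n : i + d < n
      i+d<n = subst (i + d <_) len (+-monoʳ-< i (m<n⇒m<1+n d<m))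
      len′ : suc (suc (i + d)) + t ≡ n
      len′ = begin
        suc (suc (i + d)) + t   ≡⟨ cong (λ k → suc k + t) (sym (+-suc i d)) ⟩
        suc (i + suc d) + t     ≡⟨ cong (_+ t) (sym (+-suc i (suc d))) ⟩
        i + suc (suc d) + t     ≡⟨ +-assoc i (suc (suc d)) t ⟩
        i + suc (suc d + t)     ≡⟨ cong (λ k → i + suc k) m≡ ⟩
        i + suc m               ≡⟨ len ⟩
        n                       ∎

  always : ℕ → Bool
  always _ = true

  blockWords-prefix : ∀ m → suc m ≤ n → sumBelow (blockWords always) (suc m) ≡ blockWords always (suc m)
  blockWords-prefix m 1+m≤n = begin
    sumBelow (blockWords always) (suc m)                    ≡⟨ sumBelow-snoc (blockWords always) m ⟩
    sumBelow (blockWords always) m + blockWords always m    ≡⟨ +-comm (sumBelow (blockWords always) m) _ ⟩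
    blockWords always m + sumBelow (blockWords always) m    ≡⟨ blockWords-suc always m 1+m≤n ⟨
    blockWords always (suc m)                               ∎

  blockWords-always : ∀ m → suc m ≤ n → blockWords always (suc m) ≡ 2 ^ m
  blockWords-always zero    1≤n = blockWords-suc always 0 1≤n
  blockWords-always (suc m) 2+m≤n = begin
    blockWords always (suc (suc m))
      ≡⟨ blockWords-suc always (suc m) 2+m≤n ⟩
    blockWords always (suc m) + sumBelow (blockWords always) (suc m)
      ≡⟨ cong (blockWords always (suc m) +_) (blockWords-prefix m 1+m≤n) ⟩
    blockWords always (suc m) + blockWords always (suc m)
      ≡⟨ cong₂ _+_ (blockWords-always m 1+m≤n) (trans (blockWords-always m 1+m≤n) (sym (+-identityʳ (2 ^ m)))) ⟩
    2 ^ suc m ∎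
    where 1+m≤n = <⇒≤ 2+m≤n

  blockWords-never : ∀ m → blockWords (λ _ → false) m ≡ 0
  blockWords-never m =
    sum-zero (score (λ _ → false) ∘ free (n ∸ m)) (λ w → rejected (free (n ∸ m) w)) (allWords n m)
    where
    rejected : ∀ r → score (λ _ → false) r ≡ 0
    rejected nothing  = refl
    rejected (just _) = refl

  blockWords-descents : ∀ r m → m ≤ n → blockWords (_≡ᵇ r) m ≡ m C (2 * r)
  blockWords-descents zero    zero    _ = refl
  blockWords-descents (suc r) zero    _ = sym (k>n⇒nCk≡0 {0} {2 * suc r} z<s)
  blockWords-descents zero    (suc m) 1+m≤n = begin
    blockWords (_≡ᵇ 0) (suc m)
      ≡⟨ blockWords-suc (_≡ᵇ 0) m 1+m≤n ⟩
    blockWords (_≡ᵇ 0) m + sumBelow (blockWords (λ _ → false)) m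
      ≡⟨ cong₂ _+_ (blockWords-descents zero m (<⇒≤ 1+m≤n)) (sumBelow-zero m (λ j _ → blockWords-never j)) ⟩
    1 + 0 ∎
  blockWords-descents (suc r) (suc m) 1+m≤n = begin
    blockWords (_≡ᵇ suc r) (suc m)
      ≡⟨ blockWords-suc (_≡ᵇ suc r) m 1+m≤n ⟩
    blockWords (_≡ᵇ suc r) m + sumBelow (blockWords (_≡ᵇ r)) m
      ≡⟨ cong₂ _+_ (blockWords-descents (suc r) m (<⇒≤ 1+m≤n))
                   (sumBelow-cong m (λ j j<m → blockWords-descents r j (≤-trans (<⇒≤ j<m) (<⇒≤ 1+m≤n)))) ⟩
    m C (2 * suc r) + sumBelow (_C (2 * r)) m
      ≡⟨ cong (m C (2 * suc r) +_) (hockey-stick (2 * r) m) ⟩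
    m C (2 * suc r) + m C suc (2 * r)
      ≡⟨ cong (λ k → m C k + m C suc (2 * r)) (*-suc 2 r) ⟩
    m C suc (suc (2 * r)) + m C suc (2 * r)
      ≡⟨ +-comm (m C suc (suc (2 * r))) _ ⟩
    m C suc (2 * r) + m C suc (suc (2 * r))
      ≡⟨ nCk+nC[k+1]≡[n+1]C[k+1] m (suc (2 * r)) ⟩
    suc m C suc (suc (2 * r))
      ≡⟨ cong (suc m C_) (*-suc 2 r) ⟨
    suc m C (2 * suc r) ∎

count-by-descents : ∀ n (g : ℕ → Bool) {Q : Pred (Vec (Fin n) n) 0ℓ} (Q? : Decidable Q) →
  (∀ σ → Q σ ⇔ (maxdrop σ ≤ 1 × T (g (des σ)))) → count231 n Q? ≡ BlockWords.blockWords n g n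
count-by-descents n g {Q} Q? Q⇔ = begin
  count231 n Q?            ≡⟨ count-filter (λ σ → isPerm? σ ×-dec avoids231? σ) Q? (score g ∘ free 0)
                                           counted uncounted (allWords n n) ⟩
  tally g n (free 0)       ≡⟨ cong (λ i → tally g n (free i)) (sym (n∸n≡0 n)) ⟩
  blockWords g n           ∎
  where
  open BlockWords n
  counted : ∀ σ → IsPerm σ × Avoids231 σ → Q σ → score g (free 0 σ) ≡ 1
  counted σ (perm , _) q with Equivalence.to (Q⇔ σ) q
  ... | md , g[des] rewrite parse-complete σ perm md | Equivalence.to T-≡ g[des] = refl

  uncounted : ∀ σ → ¬ ((IsPerm σ × Avoids231 σ) × Q σ) → score g (free 0 σ) ≡ 0
  uncounted σ ¬counted with free 0 σ in parsed
  ... | nothing = refl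
  ... | just c with g c in g[c]
  ...   | false = refl
  ...   | true  = ⊥-elim (¬counted (perm-avoids , Equivalence.from (Q⇔ σ) (md , g[des])))
    where
    perm-avoids = proj₁ (parse-sound σ parsed)
    md = proj₁ (proj₂ (parse-sound σ parsed))
    g[des] = subst (T ∘ g) (sym (proj₂ (proj₂ (parse-sound σ parsed)))) (Equivalence.from T-≡ g[c])

-- Both counts follow from the enumeration of block words; part (2) holds without the
-- hypotheses 1 ≤ r and 2r ≤ n (for 2r > n both sides vanish).
theorem2 : (∀ (n : ℕ) → 1 ≤ n →
             count231 n (λ σ → maxdrop σ ≤? 1) ≡ 2 ^ (n ∸ 1))
           × (∀ (r n : ℕ) → 1 ≤ r → 2 * r ≤ n →
             count231 n (λ σ → (maxdrop σ ≤? 1) ×-dec (des σ ≟ r)) ≡ n C (2 * r))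
theorem2 = all-permutations , by-descents
  where
  all-permutations : ∀ (n : ℕ) → 1 ≤ n → count231 n (λ σ → maxdrop σ ≤? 1) ≡ 2 ^ (n ∸ 1)
  all-permutations (suc m) _ = begin
    count231 (suc m) (λ σ → maxdrop σ ≤? 1)
      ≡⟨ count-by-descents (suc m) always _ (λ σ → mk⇔ (_, tt) proj₁) ⟩
    blockWords always (suc m)
      ≡⟨ blockWords-always m ≤-refl ⟩
    2 ^ m ∎
    where open BlockWords (suc m)

  by-descents : ∀ (r n : ℕ) → 1 ≤ r → 2 * r ≤ n →
    count231 n (λ σ → (maxdrop σ ≤? 1) ×-dec (des σ ≟ r)) ≡ n C (2 * r)
  by-descents r n _ _ = begin
    count231 n (λ σ → (maxdrop σ ≤? 1) ×-dec (des σ ≟ r))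
      ≡⟨ count-by-descents n (_≡ᵇ r) _ (λ σ → mk⇔ (map₂ (≡⇒≡ᵇ _ r)) (map₂ (≡ᵇ⇒≡ _ r))) ⟩
    blockWords (_≡ᵇ r) n
      ≡⟨ blockWords-descents r n ≤-refl ⟩
    n C (2 * r) ∎
    where open BlockWords n
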